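{- Let $m$ and $M$ be two positive integers. If $\mathsf{D}(\llbracket -m,M \rrbracket ) = m+M$, then $\rho (m,M)=0$ and the only minimal zero-sum sequence over $\llbracket -m,M \rrbracket$ of length $m+M$ is $M^m \cdot (-m)^M$.
   Context: Sequences of integers are unordered finite multisets written multiplicatively: $x^a$ denotes $a$ copies of $x$, $\cdot$ denotes concatenation; the length is the number of elements with multiplicity. $S=s_1\cdots s_n$ is a zero-sum sequence if $\sum s_i=0$, and minimal if moreover $\sum_{i\in I}s_i\ne0$ for every non-empty proper $I\subsetneq\{1,\dots,n\}$. A sequence is over a set $A$ if all its elements lie in $A$. For integers $a\le b$, $\llbracket a,b\rrbracket$ is the set of integers between $a$ and $b$. $\mathsf{D}(\llbracket -m,M\rrbracket)$ is the maximal length of a minimal zero-sum sequence over $\llbracket -m,M\rrbracket$. Define $\rho(m,M)=\min\{t\in\mathbb{Z}_{\ge 0} : \exists\, t'\in\mathbb{Z},\ 0\le t'\le t,\ \gcd(M-t',\,m-(t-t'))=1\}$. -}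

module Defs where

open import Data.Nat as ℕ using (ℕ)
open import Data.Nat.GCD as ℕG using ()
open import Data.Integer using (ℤ; +_; -_; _-_; _≤_; ∣_∣; _+_)
open import Data.Integer.GCD using (gcd)
open import Data.List using (List; []; _∷_; length; replicate; _++_)
open import Data.List.Relation.Unary.All using (All)
open import Data.Fin using (Fin)
open import Data.Bool using (Bool; true; false)
open import Data.Product using (Σ; _×_; ∃; ∃-syntax)
open import Relation.Binary.PropositionalEquality using (_≡_; _≢_)
open import Relation.Nullary using (¬_)

sum : List ℤ → ℤ
sum [] = + 0
sum (x ∷ S) = x + sum S

InInterval : ℤ → ℤ → ℤ → Set
InInterval a b x = (a ≤ x) × (x ≤ b)

-- a sequence (finite multiset) of integers is represented by a list;
-- multiset equality is list permutation (_↭_)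

SeqOver : ℤ → ℤ → List ℤ → Set
SeqOver a b S = All (InInterval a b) S

-- a subsequence of S indexed by a subset I of positions {0..|S|-1},
-- encoded as a Boolean mask of the list
select : (S : List ℤ) → (Fin (length S) → Bool) → List ℤ
select [] I = []
select (x ∷ S) I with I Fin.zero
... | true  = x ∷ select S (λ i → I (Fin.suc i))
... | false = select S (λ i → I (Fin.suc i))

count : {n : ℕ} → (Fin n → Bool) → ℕ
count {ℕ.zero} I = 0
count {ℕ.suc n} I with I Fin.zero
... | true  = ℕ.suc (count (λ i → I (Fin.suc i)))
... | false = count (λ i → I (Fin.suc i))

IsZeroSum : List ℤ → Set
IsZeroSum S = sum S ≡ + 0

-- minimal zero-sum sequence: zero-sum, nonempty (the empty sequence is
-- not minimal by the paper's convention), and no nonempty proper index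
-- set I ⊊ {1..n} has zero sum
IsMinimalZeroSum : List ℤ → Set
IsMinimalZeroSum S =
  IsZeroSum S × (S ≢ []) ×
  ((I : Fin (length S) → Bool) →
     0 ℕ.< count I → count I ℕ.< length S → sum (select S I) ≢ + 0)

DIs : ℕ → ℕ → ℕ → Set
DIs m M d =
  (∃[ S ] (SeqOver (- + m) (+ M) S × IsMinimalZeroSum S × length S ≡ d)) ×
  ((S : List ℤ) → SeqOver (- + m) (+ M) S → IsMinimalZeroSum S → length S ℕ.≤ d)

RhoCond : ℕ → ℕ → ℕ → Set
RhoCond m M t = ∃[ t' ] ((t' ℕ.≤ t) ×
  (gcd (+ M - + t') (+ m - (+ t - + t')) ≡ + 1))

RhoIs : ℕ → ℕ → ℕ → Set
RhoIs m M r = RhoCond m M r × ((t : ℕ) → t ℕ.< r → ¬ RhoCond m M t)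

{-# OPTIONS --safe #-}
-- Split a minimal zero-sum sequence S over ⟦-m, M⟧ into its nonnegative part A ⊆ ⟦0, M⟧ and
-- the absolute values B ⊆ ⟦1, m⟧ of its negative part, so that ΣA = ΣB and no proper
-- nonempty U ⊆ A, V ⊆ B has ΣU = ΣV.  Interleave A and B greedily: take the next element
-- of B while the prefix sum of B is behind that of A, and the next element of A otherwise.
-- The difference of the two prefix sums then stays in ⟦-m+1, M⟧, and two equal differences
-- would cut out a proper balanced pair of segments, so |S| ≤ m + M.  If A has an element
-- x < M, put it first: then the difference never reaches M and |S| < m + M.  Hence a
-- sequence of length m + M has A = M^m and B = m^M, and a common divisor d > 1 of m and
-- M would give the proper zero-sum subsequence M^(m/d) · (-m)^(M/d).
module Submission where

open import Defs
open import Data.Nat using (ℕ; _+_; _<_)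
open import Data.Integer using (ℤ; +_; -_)
open import Relation.Binary.PropositionalEquality using (_≡_)
open import Data.List using (List; length; replicate; _++_)
open import Data.Product using (_×_)
open import Data.List.Relation.Binary.Permutation.Propositional using (_↭_)

open import Algebra.Bundles using (CommutativeMonoid)
import Algebra.Properties.CommutativeSemigroup as CommutativeSemigroupProperties
open import Data.Bool using (true; false)
open import Data.Empty using (⊥; ⊥-elim)
open import Data.Fin as Fin using (toℕ; fromℕ<)
import Data.Fin.Properties as Finₚ
import Data.Integer as ℤ
open import Data.Integer using (-[1+_]; +≤+)
import Data.Integer.Properties as ℤₚ
open import Data.Integer.GCD using (gcd)
open import Data.List using ([]; _∷_; map; take; drop; foldr)
open import Data.List.Properties
  using (length-++; length-map; length-take; length-drop; length-replicate; take++drop≡id;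
         take-take; take-all; map-replicate)
open import Data.List.Membership.Propositional using (_∈_)
open import Data.List.Membership.Propositional.Properties using (∈-∃++)
open import Data.List.Relation.Unary.All as All using (All; []; _∷_)
open import Data.List.Relation.Binary.Sublist.Propositional using (_⊆_; []; _∷_; _∷ʳ_; ⊆-trans)
open import Data.List.Relation.Binary.Sublist.Propositional.Properties
  using (map⁺; ++⁺; take-⊆; drop-⊆)
open import Data.List.Relation.Binary.Permutation.Propositional
  using (refl; prep; swap; ↭-sym; ↭⇒↭ₛ) renaming (trans to ↭-trans)
open import Data.List.Relation.Binary.Permutation.Propositional.Properties
  using (↭-length; All-resp-↭; shift)
open import Data.List.Relation.Binary.Permutation.Setoid.Properties using (foldr-commMonoid)
open import Data.Nat using (zero; suc; _≤_; _∸_; _*_; _⊓_; z≤n; s≤s; _≤′_; ≤′-refl; ≤′-step;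
  >-nonZero)
open import Data.Nat.Properties
open import Data.Nat.Coprimality using (Coprime; coprime⇒gcd≡1)
open import Data.Nat.Divisibility using (divides)
open import Data.Nat.ListAction using () renaming (sum to sumℕ)
open import Data.Nat.ListAction.Properties using () renaming (sum-++ to sumℕ-++; sum-↭ to sumℕ-↭)
open import Data.Product using (∃-syntax; _,_; proj₁; proj₂)
open import Data.Sum using (inj₁; inj₂)
open import Function using (_∘_)
open import Relation.Nullary using (yes; no; contradiction)
open import Relation.Binary.PropositionalEquality
  using (_≢_; refl; sym; trans; cong; cong₂; subst; subst₂; module ≡-Reasoning)

open ≡-Reasoning
module +-CS = CommutativeSemigroupProperties +-commutativeSemigroup
module *-CS = CommutativeSemigroupProperties *-commutativeSemigroup

↭-pullback-⊆ : {X : Set} {xs ys us : List X} → xs ↭ ys → us ⊆ ys →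
               ∃[ vs ] (vs ⊆ xs × vs ↭ us)
↭-pullback-⊆ {us = us} refl us⊆ys = us , us⊆ys , refl
↭-pullback-⊆ (prep x p) (.x ∷ʳ us⊆ys)
  with vs , vs⊆xs , vs↭us ← ↭-pullback-⊆ p us⊆ys = vs , x ∷ʳ vs⊆xs , vs↭us
↭-pullback-⊆ (prep x p) (refl ∷ us⊆ys)
  with vs , vs⊆xs , vs↭us ← ↭-pullback-⊆ p us⊆ys = x ∷ vs , refl ∷ vs⊆xs , prep x vs↭us
↭-pullback-⊆ (swap x y p) (.y ∷ʳ .x ∷ʳ us⊆ys)
  with vs , vs⊆xs , vs↭us ← ↭-pullback-⊆ p us⊆ys = vs , x ∷ʳ y ∷ʳ vs⊆xs , vs↭us
↭-pullback-⊆ (swap x y p) (.y ∷ʳ refl ∷ us⊆ys)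
  with vs , vs⊆xs , vs↭us ← ↭-pullback-⊆ p us⊆ys = x ∷ vs , refl ∷ y ∷ʳ vs⊆xs , prep x vs↭us
↭-pullback-⊆ (swap x y p) (refl ∷ .x ∷ʳ us⊆ys)
  with vs , vs⊆xs , vs↭us ← ↭-pullback-⊆ p us⊆ys = y ∷ vs , x ∷ʳ refl ∷ vs⊆xs , prep y vs↭us
↭-pullback-⊆ (swap x y p) (refl ∷ refl ∷ us⊆ys)
  with vs , vs⊆xs , vs↭us ← ↭-pullback-⊆ p us⊆ys = x ∷ y ∷ vs , refl ∷ refl ∷ vs⊆xs , swap x y vs↭us
↭-pullback-⊆ (↭-trans p q) us⊆zs
  with ws , ws⊆ys , ws↭us ← ↭-pullback-⊆ q us⊆zs
  with vs , vs⊆xs , vs↭ws ← ↭-pullback-⊆ p ws⊆ys = vs , vs⊆xs , ↭-trans vs↭ws ws↭us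

∈⇒↭-∷ : {X : Set} {x : X} {xs : List X} → x ∈ xs → ∃[ ys ] (xs ↭ x ∷ ys)
∈⇒↭-∷ x∈xs with ys , zs , refl ← ∈-∃++ x∈xs = ys ++ zs , shift _ ys zs

replicate-⊆ : {X : Set} {x : X} {a b : ℕ} → a ≤ b → replicate a x ⊆ replicate b x
replicate-⊆ {b = zero}  z≤n = []
replicate-⊆ {b = suc b} z≤n = _ ∷ʳ replicate-⊆ z≤n
replicate-⊆ (s≤s a≤b) = refl ∷ replicate-⊆ a≤b

All≡⇒replicate : {X : Set} {x : X} {xs : List X} → All (_≡ x) xs → xs ≡ replicate (length xs) x
All≡⇒replicate [] = refl
All≡⇒replicate (refl ∷ xs≡x) = cong (_ ∷_) (All≡⇒replicate xs≡x)

segment : {X : Set} → ℕ → ℕ → List X → List X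
segment i i′ xs = drop i (take i′ xs)

segment-⊆ : {X : Set} (i i′ : ℕ) (xs : List X) → segment i i′ xs ⊆ xs
segment-⊆ i i′ xs = ⊆-trans (drop-⊆ i (take i′ xs)) (take-⊆ i′ xs)

length-segment : {X : Set} {i i′ : ℕ} (xs : List X) → i ≤ i′ → i′ ≤ length xs →
                 length (segment i i′ xs) + i ≡ i′
length-segment {i = i} {i′} xs i≤i′ i′≤|xs| = begin
  length (drop i (take i′ xs)) + i ≡⟨ cong (_+ i) (length-drop i (take i′ xs)) ⟩
  length (take i′ xs) ∸ i + i      ≡⟨ cong (λ l → l ∸ i + i) (length-take i′ xs) ⟩
  i′ ⊓ length xs ∸ i + i           ≡⟨ cong (λ l → l ∸ i + i) (m≤n⇒m⊓n≡m i′≤|xs|) ⟩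
  i′ ∸ i + i                       ≡⟨ m∸n+n≡m i≤i′ ⟩
  i′                               ∎

sumℕ-replicate : ∀ n x → sumℕ (replicate n x) ≡ n * x
sumℕ-replicate zero    x = refl
sumℕ-replicate (suc n) x = cong (_+_ x) (sumℕ-replicate n x)

sumℕ-take-segment : ∀ {i i′} xs → i ≤ i′ →
                    sumℕ (take i′ xs) ≡ sumℕ (take i xs) + sumℕ (segment i i′ xs)
sumℕ-take-segment {i} {i′} xs i≤i′ = begin
  sumℕ (take i′ xs)                        ≡⟨ cong sumℕ (take++drop≡id i (take i′ xs)) ⟨
  sumℕ (take i (take i′ xs) ++ seg)        ≡⟨ sumℕ-++ (take i (take i′ xs)) seg ⟩
  sumℕ (take i (take i′ xs)) + sumℕ seg    ≡⟨ cong (λ ys → sumℕ ys + sumℕ seg) (take-take i i′ xs) ⟩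
  sumℕ (take (i ⊓ i′) xs) + sumℕ seg       ≡⟨ cong (λ k → sumℕ (take k xs) + sumℕ seg) (m≤n⇒m⊓n≡m i≤i′) ⟩
  sumℕ (take i xs) + sumℕ seg              ∎
  where
  seg : List ℕ
  seg = segment i i′ xs

sumℕ-take≤sumℕ : ∀ i xs → sumℕ (take i xs) ≤ sumℕ xs
sumℕ-take≤sumℕ i xs = subst (sumℕ (take i xs) ≤_) total (m≤m+n _ _)
  where
  total : sumℕ (take i xs) + sumℕ (drop i xs) ≡ sumℕ xs
  total = trans (sym (sumℕ-++ (take i xs) (drop i xs))) (cong sumℕ (take++drop≡id i xs))

sumℕ-take-length : ∀ xs → sumℕ (take (length xs) xs) ≡ sumℕ xs
sumℕ-take-length xs = cong sumℕ (take-all (length xs) xs ≤-refl)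

sumℕ-take-suc : ∀ {P : ℕ → Set} {i xs} → All P xs → i < length xs →
                ∃[ a ] (P a × sumℕ (take (suc i) xs) ≡ sumℕ (take i xs) + a)
sumℕ-take-suc {i = zero}  {x ∷ _} (px ∷ _) _ = x , px , +-identityʳ x
sumℕ-take-suc {i = suc i} {x ∷ _} (_ ∷ pxs) (s≤s i<|xs|)
  with a , pa , eq ← sumℕ-take-suc pxs i<|xs| =
  a , pa , trans (cong (_+_ x) eq) (sym (+-assoc x _ a))

pigeonhole-ℕ : ∀ {c N} (f : ℕ → ℕ) → c < N → (∀ {k} → k < N → f k < c) →
               ∃[ a ] ∃[ b ] (a < b × b < N × f a ≡ f b)
pigeonhole-ℕ f c<N f<c
  with i , j , i<j , fi≡fj ← Finₚ.pigeonhole c<N (λ k → fromℕ< (f<c (Finₚ.toℕ<n k))) =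
  toℕ i , toℕ j , i<j , Finₚ.toℕ<n j ,
  trans (sym (Finₚ.toℕ-fromℕ< _)) (trans (cong toℕ fi≡fj) (Finₚ.toℕ-fromℕ< _))

sum-++ : ∀ xs ys → sum (xs ++ ys) ≡ sum xs ℤ.+ sum ys
sum-++ []       ys = sym (ℤₚ.+-identityˡ (sum ys))
sum-++ (x ∷ xs) ys = trans (cong (ℤ._+_ x) (sum-++ xs ys)) (sym (ℤₚ.+-assoc x (sum xs) (sum ys)))

sum≗foldr : ∀ xs → sum xs ≡ foldr ℤ._+_ (+ 0) xs
sum≗foldr []       = refl
sum≗foldr (x ∷ xs) = cong (ℤ._+_ x) (sum≗foldr xs)

sum-↭ : ∀ {xs ys} → xs ↭ ys → sum xs ≡ sum ys
sum-↭ {xs} {ys} p = begin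
  sum xs                 ≡⟨ sum≗foldr xs ⟩
  foldr ℤ._+_ (+ 0) xs   ≡⟨ foldr-commMonoid ℤ-+-0.setoid ℤ-+-0.isCommutativeMonoid (↭⇒↭ₛ p) ⟩
  foldr ℤ._+_ (+ 0) ys   ≡⟨ sum≗foldr ys ⟨
  sum ys                 ∎
  where module ℤ-+-0 = CommutativeMonoid ℤₚ.+-0-commutativeMonoid

signed : List ℕ → List ℕ → List ℤ
signed A B = map +_ A ++ map (λ b → - + b) B

length-signed : ∀ A B → length (signed A B) ≡ length A + length B
length-signed A B = trans (length-++ (map +_ A)) (cong₂ _+_ (length-map +_ A) (length-map _ B))

sum-signed : ∀ A B → sum (signed A B) ≡ + sumℕ A ℤ.- + sumℕ B
sum-signed A B = trans (sum-++ (map +_ A) _) (cong₂ ℤ._+_ (sum-nonneg A) (sum-neg B))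
  where
  sum-nonneg : ∀ A → sum (map +_ A) ≡ + sumℕ A
  sum-nonneg []      = refl
  sum-nonneg (a ∷ A) = cong (ℤ._+_ (+ a)) (sum-nonneg A)
  sum-neg : ∀ B → sum (map (λ b → - + b) B) ≡ - + sumℕ B
  sum-neg []      = refl
  sum-neg (b ∷ B) =
    trans (cong (ℤ._+_ (- + b)) (sum-neg B)) (sym (ℤₚ.neg-distrib-+ (+ b) (+ sumℕ B)))

signed-⊆ : ∀ {U A V B} → U ⊆ A → V ⊆ B → signed U V ⊆ signed A B
signed-⊆ U⊆A V⊆B = ++⁺ (map⁺ +_ U⊆A) (map⁺ _ V⊆B)

signed-replicate : ∀ m M →
                   signed (replicate m M) (replicate M m) ≡ replicate m (+ M) ++ replicate M (- + m)
signed-replicate m M = cong₂ _++_ (map-replicate +_ m M) (map-replicate _ M m)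

nonnegatives : List ℤ → List ℕ
nonnegatives []             = []
nonnegatives (+ n ∷ S)      = n ∷ nonnegatives S
nonnegatives (-[1+ n ] ∷ S) = nonnegatives S

negatives : List ℤ → List ℕ
negatives []             = []
negatives (+ n ∷ S)      = negatives S
negatives (-[1+ n ] ∷ S) = suc n ∷ negatives S

↭-signed-parts : ∀ S → S ↭ signed (nonnegatives S) (negatives S)
↭-signed-parts []             = refl
↭-signed-parts (+ n ∷ S)      = prep (+ n) (↭-signed-parts S)
↭-signed-parts (-[1+ n ] ∷ S) =
  ↭-trans (prep -[1+ n ] (↭-signed-parts S)) (↭-sym (shift -[1+ n ] (map +_ (nonnegatives S)) _))

nonnegatives-≤ : ∀ {m M S} → SeqOver (- + m) (+ M) S → All (_≤ M) (nonnegatives S)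
nonnegatives-≤ {S = []}             []                       = []
nonnegatives-≤ {S = + n ∷ _}        ((_ , +≤+ n≤M) ∷ S-over) = n≤M ∷ nonnegatives-≤ S-over
nonnegatives-≤ {S = -[1+ n ] ∷ _}   (_ ∷ S-over)             = nonnegatives-≤ S-over

negatives-≤ : ∀ {m M S} → SeqOver (- + m) (+ M) S → All (_≤ m) (negatives S)
negatives-≤ {S = []}                []                 = []
negatives-≤ {S = + n ∷ _}           (_ ∷ S-over)       = negatives-≤ S-over
negatives-≤ {m} {S = -[1+ n ] ∷ _}  ((lo , _) ∷ S-over) =
  ℤₚ.drop‿+≤+ (ℤₚ.neg-cancel-≤ {+ m} {+ suc n} lo) ∷ negatives-≤ S-over

⊆⇒select : ∀ {U S} → U ⊆ S → ∃[ I ] (select S I ≡ U × count I ≡ length U)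
⊆⇒select [] = (λ ()) , refl , refl
⊆⇒select (_ ∷ʳ U⊆S) with I , selected , counted ← ⊆⇒select U⊆S =
  (λ { Fin.zero → false ; (Fin.suc i) → I i }) , selected , counted
⊆⇒select (refl ∷ U⊆S) with I , selected , counted ← ⊆⇒select U⊆S =
  (λ { Fin.zero → true ; (Fin.suc i) → I i }) , cong (_ ∷_) selected , cong suc counted

minimal⇒no-proper-zero-sum-sublist : ∀ {S U} → IsMinimalZeroSum S → U ⊆ S → sum U ≡ + 0 →
                                     0 < length U → length U < length S → ⊥
minimal⇒no-proper-zero-sum-sublist {S} (_ , _ , minimal) U⊆S ΣU≡0 0<|U| |U|<|S|
  with I , selected , counted ← ⊆⇒select U⊆S =
  minimal I (subst (0 <_) (sym counted) 0<|U|) (subst (_< length S) (sym counted) |U|<|S|)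
    (trans (cong sum selected) ΣU≡0)

-- Balanced pairs

NoProperBalancedSubpair : List ℕ → List ℕ → Set
NoProperBalancedSubpair A B = ∀ {U V} → U ⊆ A → V ⊆ B → sumℕ U ≡ sumℕ V →
  0 < length U + length V → length U + length V < length A + length B → ⊥

NoProperBalancedSubpair-sym : ∀ {A B} → NoProperBalancedSubpair A B → NoProperBalancedSubpair B A
NoProperBalancedSubpair-sym {A} {B} irreducible {V} {U} V⊆B U⊆A ΣV≡ΣU 0<|V|+|U| |V|+|U|<|B|+|A| =
  irreducible U⊆A V⊆B (sym ΣV≡ΣU) (subst (0 <_) (+-comm (length V) (length U)) 0<|V|+|U|)
    (subst₂ _<_ (+-comm (length V) (length U)) (+-comm (length B) (length A)) |V|+|U|<|B|+|A|)

NoProperBalancedSubpair-resp-↭ˡ : ∀ {A A′ B} → A ↭ A′ →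
                                  NoProperBalancedSubpair A B → NoProperBalancedSubpair A′ B
NoProperBalancedSubpair-resp-↭ˡ {B = B} A↭A′ irreducible {U′} {V} U′⊆A′ V⊆B ΣU′≡ΣV 0<|U′|+|V| |U′|+|V|<
  with U , U⊆A , U↭U′ ← ↭-pullback-⊆ A↭A′ U′⊆A′ =
  irreducible U⊆A V⊆B (trans (sumℕ-↭ U↭U′) ΣU′≡ΣV)
    (subst (λ l → 0 < l + length V) (sym (↭-length U↭U′)) 0<|U′|+|V|)
    (subst₂ (λ l n → l + length V < n + length B) (sym (↭-length U↭U′)) (sym (↭-length A↭A′))
      |U′|+|V|<)

minimal⇒NoProperBalancedSubpair : ∀ {S A B} → IsMinimalZeroSum S → S ↭ signed A B →
                                  NoProperBalancedSubpair A B
minimal⇒NoProperBalancedSubpair {S} {A} {B} S-minimal S↭AB {U} {V} U⊆A V⊆B ΣU≡ΣV 0<|U|+|V| |U|+|V|<n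
  with W , W⊆S , W↭UV ← ↭-pullback-⊆ S↭AB (signed-⊆ U⊆A V⊆B) =
  minimal⇒no-proper-zero-sum-sublist S-minimal W⊆S ΣW≡0
    (subst (0 <_) (sym |W|) 0<|U|+|V|) (subst₂ _<_ (sym |W|) (sym |S|) |U|+|V|<n)
  where
  |W| : length W ≡ length U + length V
  |W| = trans (↭-length W↭UV) (length-signed U V)
  |S| : length S ≡ length A + length B
  |S| = trans (↭-length S↭AB) (length-signed A B)
  ΣW≡0 : sum W ≡ + 0
  ΣW≡0 = begin
    sum W                        ≡⟨ sum-↭ W↭UV ⟩
    sum (signed U V)             ≡⟨ sum-signed U V ⟩
    + sumℕ U ℤ.- + sumℕ V        ≡⟨ cong (λ s → + s ℤ.- + sumℕ V) ΣU≡ΣV ⟩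
    + sumℕ V ℤ.- + sumℕ V        ≡⟨ ℤₚ.+-inverseʳ (+ sumℕ V) ⟩
    + 0                          ∎

minimal⇒balanced-parts : ∀ {S} → IsMinimalZeroSum S → sumℕ (nonnegatives S) ≡ sumℕ (negatives S)
minimal⇒balanced-parts {S} (ΣS≡0 , _) = ℤₚ.+-injective (ℤₚ.i-j≡0⇒i≡j _ _ (begin
  + sumℕ (nonnegatives S) ℤ.- + sumℕ (negatives S) ≡⟨ sum-signed (nonnegatives S) (negatives S) ⟨
  sum (signed (nonnegatives S) (negatives S))      ≡⟨ sum-↭ (↭-signed-parts S) ⟨
  sum S                                            ≡⟨ ΣS≡0 ⟩
  + 0                                              ∎))

-- The interleaving walk

module Walk {m′ M : ℕ} {A B : List ℕ} (A≤M : All (_≤ M) A) (B≤m : All (_≤ suc m′) B)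
  (balanced : sumℕ A ≡ sumℕ B) (irreducible : NoProperBalancedSubpair A B) where

  n : ℕ
  n = length A + length B

  PA : ℕ → ℕ
  PA i = sumℕ (take i A)

  PB : ℕ → ℕ
  PB j = sumℕ (take j B)

  step : ℕ × ℕ → ℕ × ℕ
  step (i , j) with PB j <? PA i
  ... | yes _ = i , suc j
  ... | no  _ = suc i , j

  walk : ℕ → ℕ × ℕ
  walk zero    = 0 , 0
  walk (suc k) = step (walk k)

  I : ℕ → ℕ
  I k = proj₁ (walk k)

  J : ℕ → ℕ
  J k = proj₂ (walk k)

  step-size : ∀ i j → proj₁ (step (i , j)) + proj₂ (step (i , j)) ≡ suc (i + j)
  step-size i j with PB j <? PA i
  ... | yes _ = +-suc i j
  ... | no  _ = refl

  step-mono : ∀ i j → i ≤ proj₁ (step (i , j)) × j ≤ proj₂ (step (i , j))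
  step-mono i j with PB j <? PA i
  ... | yes _ = ≤-refl , n≤1+n j
  ... | no  _ = n≤1+n i , ≤-refl

  I+J≡ : ∀ k → I k + J k ≡ k
  I+J≡ zero    = refl
  I+J≡ (suc k) = trans (step-size (I k) (J k)) (cong suc (I+J≡ k))

  walk-mono : ∀ {k l} → k ≤′ l → I k ≤ I l × J k ≤ J l
  walk-mono ≤′-refl = ≤-refl , ≤-refl
  walk-mono {l = suc l} (≤′-step k≤′l) =
    ≤-trans (proj₁ (walk-mono k≤′l)) (proj₁ (step-mono (I l) (J l))) ,
    ≤-trans (proj₂ (walk-mono k≤′l)) (proj₂ (step-mono (I l) (J l)))

  Fits : ℕ × ℕ → Set
  Fits (i , j) = i ≤ length A × j ≤ length B × PB j < PA i + suc m′ × PA i < PB j + M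

  PA≤PB-end : ∀ i → PA i ≤ PB (length B)
  PA≤PB-end i =
    ≤-trans (sumℕ-take≤sumℕ i A) (≤-reflexive (trans balanced (sym (sumℕ-take-length B))))

  PB≤PA-end : ∀ j → PB j ≤ PA (length A)
  PB≤PA-end j =
    ≤-trans (sumℕ-take≤sumℕ j B) (≤-reflexive (trans (sym balanced) (sym (sumℕ-take-length A))))

  -- The step adds at most m (resp. M) to the prefix sum that is strictly behind.
  step-fits : ∀ {i j} → Fits (i , j) → PA i ≢ PB j → Fits (step (i , j))
  step-fits {i} {j} (i≤|A| , j≤|B| , lo , hi) PAi≢PBj with PB j <? PA i
  ... | yes PBj<PAi with m≤n⇒m<n∨m≡n j≤|B|
  ...   | inj₂ refl = contradiction (PA≤PB-end i) (<⇒≱ PBj<PAi)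
  ...   | inj₁ j<|B| with b , b≤m , PB[j+1] ← sumℕ-take-suc B≤m j<|B| =
    i≤|A| , j<|B| ,
    subst (_< PA i + suc m′) (sym PB[j+1]) (+-mono-<-≤ PBj<PAi b≤m) ,
    subst (λ s → PA i < s + M) (sym PB[j+1]) (<-≤-trans hi (+-monoˡ-≤ M (m≤m+n (PB j) b)))
  step-fits {i} {j} (i≤|A| , j≤|B| , lo , hi) PAi≢PBj | no PBj≮PAi
    with PAi<PBj ← ≤∧≢⇒< (≮⇒≥ PBj≮PAi) PAi≢PBj with m≤n⇒m<n∨m≡n i≤|A|
  ...   | inj₂ refl = contradiction (PB≤PA-end j) (<⇒≱ PAi<PBj)
  ...   | inj₁ i<|A| with a , a≤M , PA[i+1] ← sumℕ-take-suc A≤M i<|A| =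
    i<|A| , j≤|B| ,
    subst (λ s → PB j < s + suc m′) (sym PA[i+1])
      (<-≤-trans lo (+-monoˡ-≤ (suc m′) (m≤m+n (PA i) a))) ,
    subst (_< PB j + M) (sym PA[i+1]) (+-mono-<-≤ PAi<PBj a≤M)

  walk-gaps-distinct : ∀ {a b} → a < b → b < n → Fits (walk b) →
                       PA (I b) + PB (J a) ≢ PA (I a) + PB (J b)
  walk-gaps-distinct {a} {b} a<b b<n (Ib≤|A| , Jb≤|B| , _) eq =
    irreducible (segment-⊆ (I a) (I b) A) (segment-⊆ (J a) (J b) B) segments-balanced
      (n≢0⇒n>0 λ |U|+|V|≡0 → <-irrefl (subst (λ l → l + a ≡ b) |U|+|V|≡0 |U|+|V|+a≡b) a<b)
      (≤-<-trans (≤-trans (m≤m+n _ a) (≤-reflexive |U|+|V|+a≡b)) b<n)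
    where
    Ia≤Ib : I a ≤ I b
    Ia≤Ib = proj₁ (walk-mono (≤⇒≤′ (<⇒≤ a<b)))
    Ja≤Jb : J a ≤ J b
    Ja≤Jb = proj₂ (walk-mono (≤⇒≤′ (<⇒≤ a<b)))
    U : List ℕ
    U = segment (I a) (I b) A
    V : List ℕ
    V = segment (J a) (J b) B
    |U|+|V|+a≡b : length U + length V + a ≡ b
    |U|+|V|+a≡b = begin
      length U + length V + a               ≡⟨ cong (_+_ (length U + length V)) (I+J≡ a) ⟨
      length U + length V + (I a + J a)     ≡⟨ +-CS.interchange (length U) (length V) (I a) (J a) ⟩
      (length U + I a) + (length V + J a)   ≡⟨ cong₂ _+_ (length-segment A Ia≤Ib Ib≤|A|)
                                                             (length-segment B Ja≤Jb Jb≤|B|) ⟩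
      I b + J b                             ≡⟨ I+J≡ b ⟩
      b                                     ∎
    segments-balanced : sumℕ U ≡ sumℕ V
    segments-balanced = +-cancelˡ-≡ (PA (I a) + PB (J a)) _ _ (begin
      PA (I a) + PB (J a) + sumℕ U    ≡⟨ +-CS.xy∙z≈xz∙y (PA (I a)) _ _ ⟩
      PA (I a) + sumℕ U + PB (J a)    ≡⟨ cong (_+ PB (J a)) (sumℕ-take-segment A Ia≤Ib) ⟨
      PA (I b) + PB (J a)             ≡⟨ eq ⟩
      PA (I a) + PB (J b)             ≡⟨ cong (_+_ (PA (I a))) (sumℕ-take-segment B Ja≤Jb) ⟩
      PA (I a) + (PB (J a) + sumℕ V)  ≡⟨ +-assoc (PA (I a)) _ _ ⟨
      PA (I a) + PB (J a) + sumℕ V    ∎)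

  fits : Fits (walk 1) → ∀ k → k < n → Fits (walk k)
  fits (_ , _ , _ , PA1<M) zero _ = z≤n , z≤n , s≤s z≤n , ≤-<-trans z≤n PA1<M
  fits w₁ (suc zero) _ = w₁
  fits w₁ (suc (suc k)) k+2<n =
    let k+1<n : suc k < n
        k+1<n = <-trans (n<1+n _) k+2<n
        fits[k+1] : Fits (walk (suc k))
        fits[k+1] = fits w₁ (suc k) k+1<n
    in step-fits fits[k+1] (walk-gaps-distinct (s≤s z≤n) k+1<n fits[k+1] ∘ trans (+-identityʳ _))

  -- The difference PA − PB shifted by m − 1 into ℕ; at fitting positions ∸ does not truncate.
  gap : ℕ → ℕ
  gap k = PA (I k) + m′ ∸ PB (J k)

  gap-spec : ∀ {k} → Fits (walk k) → gap k + PB (J k) ≡ PA (I k) + m′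
  gap-spec {k} (_ , _ , lo , _) = m∸n+n≡m (≤-pred (subst (PB (J k) <_) (+-suc (PA (I k)) m′) lo))

  gap< : ∀ {k} → Fits (walk k) → gap k < m′ + M
  gap< {k} fk@(_ , _ , _ , hi) = +-cancelʳ-< (PB (J k)) (gap k) (m′ + M)
    (subst₂ _<_ (sym (gap-spec {k} fk)) (+-CS.xy∙z≈zy∙x (PB (J k)) M m′) (+-monoˡ-< m′ hi))

  gap≡⇒sums≡ : ∀ {a b} → Fits (walk a) → Fits (walk b) → gap a ≡ gap b →
                PA (I b) + PB (J a) ≡ PA (I a) + PB (J b)
  gap≡⇒sums≡ {a} {b} fa fb gap[a]≡gap[b] = +-cancelʳ-≡ m′ _ _ (begin
    PA (I b) + PB (J a) + m′       ≡⟨ +-CS.xy∙z≈y∙xz (PA (I b)) _ _ ⟩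
    PB (J a) + (PA (I b) + m′)     ≡⟨ cong (_+_ (PB (J a))) (gap-spec {b} fb) ⟨
    PB (J a) + (gap b + PB (J b))  ≡⟨ cong (λ g → PB (J a) + (g + PB (J b))) gap[a]≡gap[b] ⟨
    PB (J a) + (gap a + PB (J b))  ≡⟨ +-CS.x∙yz≈yx∙z (PB (J a)) (gap a) (PB (J b)) ⟩
    gap a + PB (J a) + PB (J b)    ≡⟨ cong (_+ PB (J b)) (gap-spec {a} fa) ⟩
    PA (I a) + m′ + PB (J b)       ≡⟨ +-CS.xy∙z≈xz∙y (PA (I a)) _ _ ⟩
    PA (I a) + PB (J b) + m′       ∎)

  -- The m + M positions 0 … m + M - 1 of the walk carry only m + M - 1 possible gaps.
  long-walk-collides : Fits (walk 1) → suc m′ + M ≤ n → ⊥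
  long-walk-collides w₁ m+M≤n =
    let a , b , a<b , b<m+M , gap[a]≡gap[b] =
          pigeonhole-ℕ gap ≤-refl (λ {k} → gap< {k} ∘ fits′ k) in
    walk-gaps-distinct a<b (<-≤-trans b<m+M m+M≤n) (fits′ b b<m+M)
      (gap≡⇒sums≡ {a} {b} (fits′ a (<-trans a<b b<m+M)) (fits′ b b<m+M) gap[a]≡gap[b])
    where
    fits′ : ∀ k → k < suc m′ + M → Fits (walk k)
    fits′ k k<m+M = fits w₁ k (<-≤-trans k<m+M m+M≤n)

  length< : Fits (walk 1) → n < suc m′ + M
  length< w₁ = ≰⇒> (long-walk-collides w₁)

head<⇒length< : ∀ {m M x A B} → 0 < m → All (_≤ M) (x ∷ A) → All (_≤ m) B →
                sumℕ (x ∷ A) ≡ sumℕ B → NoProperBalancedSubpair (x ∷ A) B → x < M →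
                length (x ∷ A) + length B < m + M
head<⇒length< {suc m′} {x = x} _ x∷A≤M B≤m balanced irreducible x<M =
  Walk.length< x∷A≤M B≤m balanced irreducible
    (s≤s z≤n , z≤n , ≤-trans (s≤s z≤n) (m≤n+m (suc m′) (x + 0)) ,
     subst (_< _) (sym (+-identityʳ x)) x<M)

-- Sequences of maximal length

m+M≤length⇒all≡M : ∀ {m M A B} → 0 < m → All (_≤ M) A → All (_≤ m) B → sumℕ A ≡ sumℕ B →
                   NoProperBalancedSubpair A B → m + M ≤ length A + length B → All (_≡ M) A
m+M≤length⇒all≡M {m} {M} {A} {B} 0<m A≤M B≤m balanced irreducible long =
  All.tabulate λ a∈A → maximal a∈A (All.lookup A≤M a∈A)
  where
  maximal : ∀ {a} → a ∈ A → a ≤ M → a ≡ M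
  maximal {a} a∈A a≤M with m≤n⇒m<n∨m≡n a≤M
  ... | inj₂ a≡M = a≡M
  ... | inj₁ a<M with A′ , A↭aA′ ← ∈⇒↭-∷ a∈A =
    contradiction long (<⇒≱ (subst (λ l → l + length B < m + M) (sym (↭-length A↭aA′))
      (head<⇒length< 0<m (All-resp-↭ A↭aA′ A≤M) B≤m (trans (sym (sumℕ-↭ A↭aA′)) balanced)
        (NoProperBalancedSubpair-resp-↭ˡ A↭aA′ irreducible) a<M)))

p*M≡q*m⇒p≡m : ∀ {p q m M} → 0 < m → p * M ≡ q * m → p + q ≡ m + M → p ≡ m
p*M≡q*m⇒p≡m {p} {q} {m} {M} 0<m pM≡qm p+q≡m+M =
  *-cancelʳ-≡ p m (m + M) {{>-nonZero (<-≤-trans 0<m (m≤m+n m M))}} (begin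
    p * (m + M)     ≡⟨ *-distribˡ-+ p m M ⟩
    p * m + p * M   ≡⟨ cong (_+_ (p * m)) pM≡qm ⟩
    p * m + q * m   ≡⟨ *-distribʳ-+ m p q ⟨
    (p + q) * m     ≡⟨ cong (_* m) p+q≡m+M ⟩
    (m + M) * m     ≡⟨ *-comm (m + M) m ⟩
    m * (m + M)     ∎)

length≡m+M⇒replicate-parts : ∀ {m M A B} → 0 < m → 0 < M → All (_≤ M) A → All (_≤ m) B →
                             sumℕ A ≡ sumℕ B → NoProperBalancedSubpair A B →
                             length A + length B ≡ m + M → A ≡ replicate m M × B ≡ replicate M m
length≡m+M⇒replicate-parts {m} {M} {A} {B} 0<m 0<M A≤M B≤m balanced irreducible |A|+|B|≡m+M =
  trans A≡ (cong (λ l → replicate l M) |A|≡m) , trans B≡ (cong (λ l → replicate l m) |B|≡M)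
  where
  A≡ : A ≡ replicate (length A) M
  A≡ = All≡⇒replicate
         (m+M≤length⇒all≡M 0<m A≤M B≤m balanced irreducible (≤-reflexive (sym |A|+|B|≡m+M)))
  B≡ : B ≡ replicate (length B) m
  B≡ = All≡⇒replicate
         (m+M≤length⇒all≡M 0<M B≤m A≤M (sym balanced) (NoProperBalancedSubpair-sym irreducible)
           (≤-reflexive (sym (trans (+-comm (length B) (length A)) (trans |A|+|B|≡m+M (+-comm m M))))))
  |A|M≡|B|m : length A * M ≡ length B * m
  |A|M≡|B|m = begin
    length A * M                     ≡⟨ sumℕ-replicate (length A) M ⟨
    sumℕ (replicate (length A) M)    ≡⟨ cong sumℕ A≡ ⟨
    sumℕ A                           ≡⟨ balanced ⟩
    sumℕ B                           ≡⟨ cong sumℕ B≡ ⟩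
    sumℕ (replicate (length B) m)    ≡⟨ sumℕ-replicate (length B) m ⟩
    length B * m                     ∎
  |A|≡m : length A ≡ m
  |A|≡m = p*M≡q*m⇒p≡m 0<m |A|M≡|B|m |A|+|B|≡m+M
  |B|≡M : length B ≡ M
  |B|≡M = +-cancelˡ-≡ m _ _ (trans (cong (_+ length B) (sym |A|≡m)) |A|+|B|≡m+M)

minimal-of-length-m+M : ∀ {m M S} → 0 < m → 0 < M → SeqOver (- + m) (+ M) S →
                        IsMinimalZeroSum S → length S ≡ m + M →
                        S ↭ signed (replicate m M) (replicate M m) ×
                        NoProperBalancedSubpair (replicate m M) (replicate M m)
minimal-of-length-m+M {m} {M} {S} 0<m 0<M S-over S-minimal |S|≡m+M =
  subst₂ (λ A B → S ↭ signed A B × NoProperBalancedSubpair A B) (proj₁ parts) (proj₂ parts)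
    (S↭ , irreducible)
  where
  S↭ : S ↭ signed (nonnegatives S) (negatives S)
  S↭ = ↭-signed-parts S
  irreducible : NoProperBalancedSubpair (nonnegatives S) (negatives S)
  irreducible = minimal⇒NoProperBalancedSubpair S-minimal S↭
  |parts| : length (nonnegatives S) + length (negatives S) ≡ m + M
  |parts| = trans (sym (trans (↭-length S↭) (length-signed (nonnegatives S) (negatives S)))) |S|≡m+M
  parts : nonnegatives S ≡ replicate m M × negatives S ≡ replicate M m
  parts = length≡m+M⇒replicate-parts 0<m 0<M (nonnegatives-≤ S-over) (negatives-≤ S-over)
            (minimal⇒balanced-parts S-minimal) irreducible |parts|

-- A common divisor d > 1 of M = a d and m = b d yields the proper balanced pair M^b, m^a.
NoProperBalancedSubpair-replicate⇒coprime : ∀ {m M} → 0 < m → 0 < M →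
  NoProperBalancedSubpair (replicate m M) (replicate M m) → Coprime M m
NoProperBalancedSubpair-replicate⇒coprime 0<m 0<M irreducible {zero} (divides a M≡a*0 , _) =
  contradiction (sym (trans M≡a*0 (*-zeroʳ a))) (<⇒≢ 0<M)
NoProperBalancedSubpair-replicate⇒coprime 0<m 0<M irreducible {suc zero} _ = refl
NoProperBalancedSubpair-replicate⇒coprime {m} {M} 0<m 0<M irreducible {d@(suc (suc _))}
  (divides a M≡ad , divides b m≡bd) =
  ⊥-elim (irreducible (replicate-⊆ (<⇒≤ b<m)) (replicate-⊆ a≤M) balanced
    (subst (0 <_) (sym |U|+|V|) (<-≤-trans 0<b (m≤m+n b a)))
    (subst₂ _<_ (sym |U|+|V|) (sym (cong₂ _+_ (length-replicate m) (length-replicate M)))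
      (+-mono-<-≤ b<m a≤M)))
  where
  0<b : 0 < b
  0<b = n≢0⇒n>0 λ { refl → <⇒≢ 0<m (sym m≡bd) }
  b<m : b < m
  b<m = subst (b <_) (sym m≡bd) (m<m*n b d {{>-nonZero 0<b}} (s≤s (s≤s z≤n)))
  a≤M : a ≤ M
  a≤M = subst (a ≤_) (sym M≡ad) (m≤m*n a d)
  |U|+|V| : length (replicate b M) + length (replicate a m) ≡ b + a
  |U|+|V| = cong₂ _+_ (length-replicate b) (length-replicate a)
  balanced : sumℕ (replicate b M) ≡ sumℕ (replicate a m)
  balanced = begin
    sumℕ (replicate b M)   ≡⟨ sumℕ-replicate b M ⟩
    b * M                  ≡⟨ cong (b *_) M≡ad ⟩
    b * (a * d)            ≡⟨ *-CS.x∙yz≈y∙xz b a d ⟩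
    a * (b * d)            ≡⟨ cong (a *_) m≡bd ⟨
    a * m                  ≡⟨ sumℕ-replicate a m ⟨
    sumℕ (replicate a m)   ∎

coprime⇒ρ≡0 : ∀ {m M} → Coprime M m → RhoIs m M 0
coprime⇒ρ≡0 {m} {M} coprime = (0 , z≤n , gcd≡1) , λ _ ()
  where
  gcd≡1 : gcd (+ M ℤ.- + 0) (+ m ℤ.- (+ 0 ℤ.- + 0)) ≡ + 1
  gcd≡1 = begin
    gcd (+ M ℤ.+ + 0) (+ m ℤ.+ + 0)  ≡⟨ cong₂ gcd (ℤₚ.+-identityʳ (+ M)) (ℤₚ.+-identityʳ (+ m)) ⟩
    gcd (+ M) (+ m)                  ≡⟨ cong +_ (coprime⇒gcd≡1 coprime) ⟩
    + 1                              ∎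

proposition3p7 : (m M : ℕ) → 0 < m → 0 < M → DIs m M (m + M) →
    RhoIs m M 0 ×
    ((S : List ℤ) → SeqOver (- (+ m)) (+ M) S → IsMinimalZeroSum S →
      length S ≡ m + M → S ↭ (replicate m (+ M) ++ replicate M (- (+ m))))
proposition3p7 m M 0<m 0<M ((S₀ , S₀-over , S₀-minimal , |S₀|≡m+M) , _) = ρ≡0 , unique
  where
  ρ≡0 : RhoIs m M 0
  ρ≡0 = coprime⇒ρ≡0 (NoProperBalancedSubpair-replicate⇒coprime 0<m 0<M
          (proj₂ (minimal-of-length-m+M 0<m 0<M S₀-over S₀-minimal |S₀|≡m+M)))
  unique : (S : List ℤ) → SeqOver (- (+ m)) (+ M) S → IsMinimalZeroSum S →
           length S ≡ m + M → S ↭ (replicate m (+ M) ++ replicate M (- (+ m)))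
  unique S S-over S-minimal |S|≡m+M = subst (S ↭_) (signed-replicate m M)
    (proj₁ (minimal-of-length-m+M 0<m 0<M S-over S-minimal |S|≡m+M))
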